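{- Let $T\in\mathcal{T}_n$, and let $T^1,T^2,\ldots,T^n=T$ be its insertion history. Then the crossings of $T$ are exactly the cells belonging to the ribbons added in the successive insertions $T^i=\mathrm{Insertpoint}(T^{i-1},e^i)$, $2\le i\le n$.
   Context: A Ferrers diagram is a finite set of unit cells of $\mathbb{Z}^2$ forming left-justified rows whose lengths weakly decrease from top to bottom, considered up to translation; its boundary edges are the unit edges on its Southeast border path, ordered Southwest to Northeast. A tree-like tableau is a Ferrers diagram in which each cell is empty or pointed, such that: (1) the top-left cell is pointed (root point); (2) every non-root pointed cell has either a pointed cell above it in its column or a pointed cell to its left in its row, but not both; (3) every row and column contains a pointed cell. Its size $n$ is its number of points (half-perimeter minus 1); $\mathcal{T}_n$ is the set of those of size $n$. A crossing of $T$ is an empty cell having a pointed cell above it in its column and a pointed cell to its left in its row. The special point of $T$ is the rightmost among pointed cells that are lowest in their column. $\mathrm{Insertpoint}(T,e)$ for a boundary edge $e$: let $T'$ be obtained by inserting at $e$ a column (if $e$ is the right end of a row $r$: add a cell at the end of $r$ and every row above) or a row (if $e$ is the bottom of a column $c$: add a cell at the bottom of $c$ and every column to its left), with only the lowest cell of the new column (resp. rightmost cell of the new row) pointed. If $e$ lies Northeast of the special point of $T$ along the border path, the result is $T'$; otherwise add to $T'$ the ribbon of empty cells (connected, no $2\times 2$ square, keeping a Ferrers diagram) from the cell immediately right of the new point to the cell immediately below the special point of $T$ (nothing if $e$ is the bottom edge of the special cell); these added cells are the ribbon cells of the insertion. Every $T\in\mathcal{T}_n$ has a unique insertion history: a sequence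 $T^1,\ldots,T^n=T$ with $T^1$ the unique tableau of size 1 and $T^i=\mathrm{Insertpoint}(T^{i-1},e^i)$ for some boundary edge $e^i$ of $T^{i-1}$. -}

module Defs where

open import Data.Nat using (ℕ; zero; suc; _+_; _∸_; _<_; _≤_; _<ᵇ_; _≤ᵇ_; _≡ᵇ_)
open import Data.Bool using (Bool; true; false; _∧_; _∨_; not; if_then_else_)
open import Data.List using (List; []; _∷_; length; map; upTo; concatMap; reverse; foldl; foldr; _++_; [_])
open import Data.Nat.ListAction using (sum)
open import Data.Maybe using (Maybe; just; nothing)
open import Data.Product using (_×_; _,_; Σ; ∃; proj₁; proj₂)
open import Data.Sum using (_⊎_)
open import Data.Empty using (⊥)
open import Relation.Nullary using (¬_)
open import Relation.Binary.PropositionalEquality using (_≡_; _≢_)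

-- A (pointed) Ferrers diagram is stored as the list of its rows,
-- top to bottom; row i is a list of Booleans (true = pointed cell), so the
-- cells of row i are (i , 0) , … , (i , len T i - 1).  Row 0 is the top row,
-- column 0 the leftmost column (coordinates (row , column)).

Tab : Set
Tab = List (List Bool)

row : Tab → ℕ → List Bool
row []       _       = []
row (r ∷ _)  zero    = r
row (_ ∷ rs) (suc i) = row rs i

at : List Bool → ℕ → Bool
at []       _       = false
at (b ∷ _)  zero    = b
at (_ ∷ bs) (suc j) = at bs j

len : Tab → ℕ → ℕ
len T i = length (row T i)

nrows : Tab → ℕ
nrows = length

isCell : Tab → ℕ → ℕ → Bool
isCell T i j = j <ᵇ len T i

pt : Tab → ℕ → ℕ → Bool
pt T i j = at (row T i) j

countB : List Bool → ℕ
countB = foldr (λ b n → if b then suc n else n) 0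

size : Tab → ℕ
size T = sum (map countB T)

colHeight : Tab → ℕ → ℕ
colHeight T c = countB (map (λ r → c <ᵇ length r) T)

mkTab : ℕ → (ℕ → ℕ) → (ℕ → ℕ → Bool) → Tab
mkTab k l p = map (λ i → map (p i) (upTo (l i))) (upTo k)

IsFerrers : Tab → Set
IsFerrers T = (1 ≤ nrows T)
            × (∀ i → i < nrows T → 1 ≤ len T i)
            × (∀ i → suc i < nrows T → len T (suc i) ≤ len T i)

PointAbove : Tab → ℕ → ℕ → Set
PointAbove T i j = Σ ℕ λ i' → i' < i × pt T i' j ≡ true

PointLeft : Tab → ℕ → ℕ → Set
PointLeft T i j = Σ ℕ λ j' → j' < j × pt T i j' ≡ true

record TreeLike (T : Tab) : Set where
  field
    ferrers : IsFerrers T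
    root    : pt T 0 0 ≡ true
    parent  : ∀ i j → pt T i j ≡ true → (i , j) ≢ (0 , 0) →
              (PointAbove T i j × ¬ PointLeft T i j)
              ⊎ (¬ PointAbove T i j × PointLeft T i j)
    rowPt   : ∀ i → i < nrows T → Σ ℕ λ j → pt T i j ≡ true
    colPt   : ∀ j → j < len T 0 → Σ ℕ λ i → pt T i j ≡ true

Crossing : Tab → ℕ → ℕ → Set
Crossing T i j = isCell T i j ≡ true × pt T i j ≡ false
               × PointAbove T i j × PointLeft T i j

-- colE c : bottom edge of column c ;  rowN r : right end (edge) of row r
data Edge : Set where
  colE : ℕ → Edge
  rowN : ℕ → Edge

_==E_ : Edge → Edge → Bool
colE a ==E colE b = a ≡ᵇ b
rowN a ==E rowN b = a ≡ᵇ b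
colE _ ==E rowN _ = false
rowN _ ==E colE _ = false

range : ℕ → ℕ → List ℕ
range a b = map (a +_) (upTo (b ∸ a))

-- the Southeast border path, listed from Southwest to Northeast
border : Tab → List Edge
border T = concatMap seg (reverse (upTo (nrows T)))
  where
    seg : ℕ → List Edge
    seg r = map colE (range (len T (suc r)) (len T r)) ++ [ rowN r ]

-- position of an edge in a list (length of the list if absent)
indexOf : Edge → List Edge → ℕ
indexOf e []       = 0
indexOf e (f ∷ fs) = if e ==E f then 0 else suc (indexOf e fs)

isBoundary : Tab → Edge → Bool
isBoundary T e = indexOf e (border T) <ᵇ length (border T)

-- column of the special point: rightmost column whose bottom cell is pointed
specialCol : Tab → Maybe ℕ
specialCol T =
  foldl (λ acc c → if pt T (colHeight T c ∸ 1) c then just c else acc)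
        nothing (upTo (len T 0))

-- One insertion step: resulting tableau, embedding of the cells of the old
-- tableau into the new one, and the ribbon cells (new coordinates).
record Step : Set where
  constructor step
  field
    tab : Tab
    emb : ℕ × ℕ → ℕ × ℕ
    rib : ℕ → ℕ → Bool

insRaw : Tab → Edge → Tab × (ℕ × ℕ → ℕ × ℕ) × (ℕ × ℕ)
insRaw T (rowN r) = mkTab (nrows T) l' p' , emb , (r , L)
  where
    L : ℕ
    L = len T r
    l' : ℕ → ℕ
    l' i = if i ≤ᵇ r then suc (len T i) else len T i
    p' : ℕ → ℕ → Bool
    p' i j = if j <ᵇ L then pt T i j else (if j ≡ᵇ L then i ≡ᵇ r else pt T i (j ∸ 1))
    emb : ℕ × ℕ → ℕ × ℕ
    emb (i , j) = (i , (if j <ᵇ L then j else suc j))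
insRaw T (colE c) = mkTab (suc (nrows T)) l' p' , emb , (H , c)
  where
    H : ℕ
    H = colHeight T c
    l' : ℕ → ℕ
    l' i = if i <ᵇ H then len T i else (if i ≡ᵇ H then suc c else len T (i ∸ 1))
    p' : ℕ → ℕ → Bool
    p' i j = if i <ᵇ H then pt T i j else (if i ≡ᵇ H then j ≡ᵇ c else pt T (i ∸ 1) j)
    emb : ℕ × ℕ → ℕ × ℕ
    emb (i , j) = ((if i <ᵇ H then i else suc i) , j)

-- Insertpoint(T , e); nothing if e is not a boundary edge of T (or T has no
-- special point).
insertpoint : Tab → Edge → Maybe Step
insertpoint T e with isBoundary T e | specialCol T
... | false | _       = nothing
... | true  | nothing = nothing
... | true  | just sc = just (step T'' emb rib)
  where
    raw = insRaw T e
    T'  = proj₁ raw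
    emb = proj₁ (proj₂ raw)
    pr  = proj₁ (proj₂ (proj₂ raw))
    pc  = proj₂ (proj₂ (proj₂ raw))
    -- special point of T, in the coordinates of T'
    sp  = emb (colHeight T sc ∸ 1 , sc)
    sr' = proj₁ sp
    sc' = proj₂ sp
    -- e lies (strictly) Northeast of the special point along the border path
    NE : Bool
    NE = indexOf (colE sc) (border T) <ᵇ indexOf e (border T)
    -- ribbon from (pr , pc+1) (right of the new point) to (sr'+1 , sc')
    -- (below the special point): the empty cells outside T' whose NW diagonal
    -- neighbour lies in T', within that bounding box
    rib : ℕ → ℕ → Bool
    rib i j = not NE ∧ (suc sr' ≤ᵇ i) ∧ (i ≤ᵇ pr) ∧ (suc pc ≤ᵇ j) ∧ (j ≤ᵇ sc')
              ∧ not (isCell T' i j) ∧ isCell T' (i ∸ 1) (j ∸ 1)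
    T'' : Tab
    T'' = mkTab (nrows T') (λ i → len T' i + countB (map (rib i) (upTo (suc sc'))))
                (pt T')

T1 : Tab
T1 = [ [ true ] ]

-- run the insertions e² , … , eⁿ starting from T
run : Tab → List Edge → Maybe (List Step)
run T [] = just []
run T (e ∷ es) with insertpoint T e
... | nothing = nothing
... | just s with run (Step.tab s) es
...   | nothing = nothing
...   | just ss = just (s ∷ ss)

finalTab : Tab → List Step → Tab
finalTab T []       = T
finalTab T (s ∷ ss) = finalTab (Step.tab s) ss

transport : List Step → ℕ × ℕ → ℕ × ℕ
transport []       c = c
transport (s ∷ ss) c = transport ss (Step.emb s c)

InRibbons : List Step → ℕ → ℕ → Set
InRibbons []       i j = ⊥
InRibbons (s ∷ ss) i j =
  (Σ ℕ λ a → Σ ℕ λ b → Step.rib s a b ≡ true × transport ss (a , b) ≡ (i , j))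
  ⊎ InRibbons ss i j

-- Crossings are followed along the insertion history. Inserting a column (or a row) at a boundary
-- edge moves the old cells without changing which of them are crossings, and creates no crossing
-- in the new line, whose only point is its last cell: the points it could supply to an old cell
-- are already supplied by the old row (column) through whose end it was inserted. Adding the
-- ribbon creates exactly the ribbon cells as new crossings, since each ribbon cell lies beyond the
-- end of its row and below the bottom of its column in the previous tableau. This only uses that
-- rows weakly decrease and every row and column contains a point, which each insertion preserves;
-- the one-cell tableau has no crossing, so induction along the history gives the result.

module Submission where

open import Defs
open import Data.Nat using (ℕ; zero; suc; _+_; _∸_; _⊓_; _⊔_; _<_; _≤_; _≥_; _>_; _<ᵇ_; _≤ᵇ_; _≡ᵇ_; z≤n; s≤s)
open import Data.Nat.Properties
open import Data.Bool using (Bool; true; false; _∧_; not; if_then_else_)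
open import Data.Bool.Properties using (T-≡; not-injective) renaming (_≟_ to _≟𝔹_)
open import Data.List using (List; []; _∷_; length; map; upTo; applyUpTo; reverse; foldl; _++_; [_])
open import Data.List.Properties using (length-map; length-applyUpTo; map-++; upTo-∷ʳ)
open import Data.List.Relation.Unary.Any using (here; there)
open import Data.List.Relation.Unary.Any.Properties using (reverse⁻)
open import Data.List.Membership.Propositional using (_∈_; find)
open import Data.List.Membership.Propositional.Properties using (∈-concatMap⁻; ∈-map⁻; ∈-++⁻; ∈-upTo⁻)
open import Data.Maybe using (Maybe; just; nothing)
open import Data.Maybe.Properties using (just-injective)
open import Data.Product using (_×_; _,_; Σ; proj₁; proj₂; uncurry)
open import Data.Sum using (_⊎_; inj₁; inj₂; assocʳ; assocˡ)
open import Data.Sum.Function.Propositional using (_⊎-⇔_)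
open import Function using (_∘_; id)
open import Function.Bundles using (_⇔_; mk⇔; Equivalence)
open import Function.Properties.Equivalence using (⇔-setoid)
open import Function.Construct.Composition using (_⇔-∘_)
open import Function.Construct.Identity using (⇔-id)
open import Level using (0ℓ)
open import Relation.Nullary using (¬_; yes; no; Dec; contradiction; _×-dec_)
open import Relation.Binary.PropositionalEquality using (_≡_; _≢_; refl; sym; trans; cong; cong₂; subst; subst₂; ≢-sym; module ≡-Reasoning)
import Relation.Binary.Reasoning.Setoid as SetoidReasoning

module ⇔-Reasoning = SetoidReasoning (⇔-setoid 0ℓ)

private
  variable
    m n : ℕ

<⇒<ᵇ≡true : m < n → (m <ᵇ n) ≡ true
<⇒<ᵇ≡true = Equivalence.to T-≡ ∘ <⇒<ᵇ

<ᵇ≡true⇒< : (m <ᵇ n) ≡ true → m < n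
<ᵇ≡true⇒< {m} {n} = <ᵇ⇒< m n ∘ Equivalence.from T-≡

≥⇒<ᵇ≡false : m ≥ n → (m <ᵇ n) ≡ false
≥⇒<ᵇ≡false {m} {n} n≤m with m <ᵇ n in eq
... | false = refl
... | true  = contradiction (<ᵇ≡true⇒< eq) (≤⇒≯ n≤m)

<ᵇ≡false⇒≥ : (m <ᵇ n) ≡ false → m ≥ n
<ᵇ≡false⇒≥ eq = ≮⇒≥ λ m<n → contradiction (trans (sym (<⇒<ᵇ≡true m<n)) eq) λ ()

≤⇒≤ᵇ≡true : m ≤ n → (m ≤ᵇ n) ≡ true
≤⇒≤ᵇ≡true = Equivalence.to T-≡ ∘ ≤⇒≤ᵇ

≤ᵇ≡true⇒≤ : (m ≤ᵇ n) ≡ true → m ≤ n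
≤ᵇ≡true⇒≤ {m} {n} = ≤ᵇ⇒≤ m n ∘ Equivalence.from T-≡

>⇒≤ᵇ≡false : m > n → (m ≤ᵇ n) ≡ false
>⇒≤ᵇ≡false {m} {n} n<m with m ≤ᵇ n in eq
... | false = refl
... | true  = contradiction (≤ᵇ≡true⇒≤ eq) (<⇒≱ n<m)

≡⇒≡ᵇ≡true : m ≡ n → (m ≡ᵇ n) ≡ true
≡⇒≡ᵇ≡true {m} {n} = Equivalence.to T-≡ ∘ ≡⇒≡ᵇ m n

≡ᵇ≡true⇒≡ : (m ≡ᵇ n) ≡ true → m ≡ n
≡ᵇ≡true⇒≡ {m} {n} = ≡ᵇ⇒≡ m n ∘ Equivalence.from T-≡

≢⇒≡ᵇ≡false : m ≢ n → (m ≡ᵇ n) ≡ false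
≢⇒≡ᵇ≡false {m} {n} m≢n with m ≡ᵇ n in eq
... | false = refl
... | true  = contradiction (≡ᵇ≡true⇒≡ eq) m≢n

true≢false : true ≢ false
true≢false ()

∧≡true⇒× : ∀ {x y} → x ∧ y ≡ true → x ≡ true × y ≡ true
∧≡true⇒× {true} {true} _ = refl , refl

m+[n∸m]≡m⊔n : ∀ m n → m + (n ∸ m) ≡ m ⊔ n
m+[n∸m]≡m⊔n m n with ≤-total m n
... | inj₁ m≤n = trans (m+[n∸m]≡n m≤n) (sym (m≤n⇒m⊔n≡n m≤n))
... | inj₂ n≤m = trans (cong (m +_) (m≤n⇒m∸n≡0 n≤m)) (trans (+-identityʳ m) (sym (m≥n⇒m⊔n≡m n≤m)))

<⊔⇒<⊎≤∧< : ∀ {j a b} → j < a ⊔ b → j < a ⊎ (a ≤ j × j < b)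
<⊔⇒<⊎≤∧< {j} {a} {b} j<a⊔b with j <? a | ≤-total a b
... | yes j<a | _       = inj₁ j<a
... | no j≮a | inj₁ a≤b = inj₂ (≮⇒≥ j≮a , subst (j <_) (m≤n⇒m⊔n≡n a≤b) j<a⊔b)
... | no j≮a | inj₂ b≤a = contradiction (subst (j <_) (m≥n⇒m⊔n≡m b≤a) j<a⊔b) j≮a

row-map-applyUpTo : ∀ (f : ℕ → List Bool) g k i → i < k → row (map f (applyUpTo g k)) i ≡ f (g i)
row-map-applyUpTo f g (suc k) zero    _         = refl
row-map-applyUpTo f g (suc k) (suc i) (s≤s i<k) = row-map-applyUpTo f (g ∘ suc) k i i<k

row-map-applyUpTo-≥ : ∀ (f : ℕ → List Bool) g k i → k ≤ i → row (map f (applyUpTo g k)) i ≡ []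
row-map-applyUpTo-≥ f g zero    i       _         = refl
row-map-applyUpTo-≥ f g (suc k) (suc i) (s≤s k≤i) = row-map-applyUpTo-≥ f (g ∘ suc) k i k≤i

at-map-applyUpTo : ∀ (f : ℕ → Bool) g k j → j < k → at (map f (applyUpTo g k)) j ≡ f (g j)
at-map-applyUpTo f g (suc k) zero    _         = refl
at-map-applyUpTo f g (suc k) (suc j) (s≤s j<k) = at-map-applyUpTo f (g ∘ suc) k j j<k

at-map-applyUpTo-≥ : ∀ (f : ℕ → Bool) g k j → k ≤ j → at (map f (applyUpTo g k)) j ≡ false
at-map-applyUpTo-≥ f g zero    j       _         = refl
at-map-applyUpTo-≥ f g (suc k) (suc j) (s≤s k≤j) = at-map-applyUpTo-≥ f (g ∘ suc) k j k≤j

length-map-upTo : ∀ {A : Set} (f : ℕ → A) k → length (map f (upTo k)) ≡ k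
length-map-upTo f k = trans (length-map f (upTo k)) (length-applyUpTo id k)

module _ (k : ℕ) (l : ℕ → ℕ) (p : ℕ → ℕ → Bool) where

  private
    mkRow : ℕ → List Bool
    mkRow i = map (p i) (upTo (l i))

    row-mkTab : ∀ i → i < k → row (mkTab k l p) i ≡ mkRow i
    row-mkTab = row-map-applyUpTo mkRow id k

    row-mkTab-≥ : ∀ i → k ≤ i → row (mkTab k l p) i ≡ []
    row-mkTab-≥ = row-map-applyUpTo-≥ mkRow id k

  nrows-mkTab : nrows (mkTab k l p) ≡ k
  nrows-mkTab = length-map-upTo mkRow k

  len-mkTab : ∀ i → i < k → len (mkTab k l p) i ≡ l i
  len-mkTab i i<k rewrite row-mkTab i i<k = length-map-upTo (p i) (l i)

  len-mkTab-≥ : ∀ i → k ≤ i → len (mkTab k l p) i ≡ 0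
  len-mkTab-≥ i k≤i rewrite row-mkTab-≥ i k≤i = refl

  pt-mkTab : ∀ i j → i < k → j < l i → pt (mkTab k l p) i j ≡ p i j
  pt-mkTab i j i<k j<l rewrite row-mkTab i i<k = at-map-applyUpTo (p i) id (l i) j j<l

  pt-mkTab-≥rows : ∀ i j → k ≤ i → pt (mkTab k l p) i j ≡ false
  pt-mkTab-≥rows i j k≤i rewrite row-mkTab-≥ i k≤i = refl

  pt-mkTab-≥len : ∀ i j → i < k → l i ≤ j → pt (mkTab k l p) i j ≡ false
  pt-mkTab-≥len i j i<k l≤j rewrite row-mkTab i i<k = at-map-applyUpTo-≥ (p i) id (l i) j l≤j

  pt-mkTab-≡ : ∀ i j {b} → p i j ≡ b → (b ≡ true → i < k × j < l i) → pt (mkTab k l p) i j ≡ b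
  pt-mkTab-≡ i j {true} p≡b inside = let (i<k , j<l) = inside refl in trans (pt-mkTab i j i<k j<l) p≡b
  pt-mkTab-≡ i j {false} p≡b _ with i <? k
  ... | no i≮k = pt-mkTab-≥rows i j (≮⇒≥ i≮k)
  ... | yes i<k with j <? l i
  ...   | yes j<l = trans (pt-mkTab i j i<k j<l) p≡b
  ...   | no j≮l  = pt-mkTab-≥len i j i<k (≮⇒≥ j≮l)

at≡true⇒< : ∀ bs j → at bs j ≡ true → j < length bs
at≡true⇒< (b ∷ bs) zero    _  = s≤s z≤n
at≡true⇒< (b ∷ bs) (suc j) eq = s≤s (at≡true⇒< bs j eq)

pt⇒<len : ∀ T i j → pt T i j ≡ true → j < len T i
pt⇒<len T i j = at≡true⇒< (row T i) j

len≤⇒¬pt : ∀ T i j → len T i ≤ j → pt T i j ≡ false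
len≤⇒¬pt T i j len≤j with pt T i j in eq
... | false = refl
... | true  = contradiction (pt⇒<len T i j eq) (≤⇒≯ len≤j)

len-≥nrows : ∀ T i → nrows T ≤ i → len T i ≡ 0
len-≥nrows []      i       _         = refl
len-≥nrows (r ∷ T) (suc i) (s≤s n≤i) = len-≥nrows T i n≤i

nrows≤⇒¬pt : ∀ T i j → nrows T ≤ i → pt T i j ≡ false
nrows≤⇒¬pt T i j n≤i = len≤⇒¬pt T i j (subst (_≤ j) (sym (len-≥nrows T i n≤i)) z≤n)

pt⇒<nrows : ∀ T i j → pt T i j ≡ true → i < nrows T
pt⇒<nrows T i j e with i <? nrows T
... | yes i<n = i<n
... | no i≮n  = contradiction (trans (sym e) (nrows≤⇒¬pt T i j (≮⇒≥ i≮n))) true≢false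

RowsDecrease : Tab → Set
RowsDecrease T = ∀ i → len T (suc i) ≤ len T i

len-antitone : ∀ T → RowsDecrease T → ∀ {i i'} → i ≤ i' → len T i' ≤ len T i
len-antitone T dec {i} {i'} i≤i' = subst (λ x → len T x ≤ len T i) (m∸n+n≡m i≤i') (go (i' ∸ i))
  where
    go : ∀ d → len T (d + i) ≤ len T i
    go zero    = ≤-refl
    go (suc d) = ≤-trans (dec (d + i)) (go d)

-- The part of the tree-like conditions that insertion preserves and the proof needs.
record PointedFerrers (T : Tab) : Set where
  field
    rowsDecrease : RowsDecrease T
    rowPoint     : ∀ i → i < nrows T → Σ ℕ λ j → pt T i j ≡ true
    columnPoint  : ∀ j → j < len T 0 → Σ ℕ λ i → pt T i j ≡ true

  rowsAntitone : ∀ {i i'} → i ≤ i' → len T i' ≤ len T i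
  rowsAntitone = len-antitone T rowsDecrease

PointAbove-cong : ∀ T T' {i j j'} → (∀ a → a < i → pt T' a j' ≡ pt T a j) →
                  PointAbove T' i j' ⇔ PointAbove T i j
PointAbove-cong T T' same = mk⇔ (λ (a , a<i , e) → a , a<i , trans (sym (same a a<i)) e)
                                (λ (a , a<i , e) → a , a<i , trans (same a a<i) e)

PointLeft-cong : ∀ T T' {i i' j} → (∀ b → b < j → pt T' i' b ≡ pt T i b) →
                 PointLeft T' i' j ⇔ PointLeft T i j
PointLeft-cong T T' same = mk⇔ (λ (b , b<j , e) → b , b<j , trans (sym (same b b<j)) e)
                               (λ (b , b<j , e) → b , b<j , trans (same b b<j) e)

Crossing-cong : ∀ T T' {i i' j j'} → isCell T' i' j' ≡ isCell T i j → pt T' i' j' ≡ pt T i j →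
                PointAbove T' i' j' ⇔ PointAbove T i j → PointLeft T' i' j' ⇔ PointLeft T i j →
                Crossing T' i' j' ⇔ Crossing T i j
Crossing-cong T T' cell point above left =
  mk⇔ (λ (c , e , a , l) → trans (sym cell) c , trans (sym point) e , Equivalence.to above a , Equivalence.to left l)
      (λ (c , e , a , l) → trans cell c , trans point e , Equivalence.from above a , Equivalence.from left l)

data Position (k : ℕ) : ℕ → Set where
  before : ∀ {j} → j < k → Position k j
  on     : Position k k
  after  : ∀ {j} → k ≤ j → Position k (suc j)

position : ∀ k j → Position k j
position zero    zero    = on
position zero    (suc j) = after z≤n
position (suc k) zero    = before (s≤s z≤n)
position (suc k) (suc j) with position k j
... | before j<k = before (s≤s j<k)
... | on         = on
... | after k≤j  = after (s≤s k≤j)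

Image : (ℕ × ℕ → ℕ × ℕ) → (ℕ → ℕ → Set) → ℕ → ℕ → Set
Image f P i j = Σ ℕ λ a → Σ ℕ λ b → P a b × f (a , b) ≡ (i , j)

Image-elim : ∀ {f P} (Q : ℕ → ℕ → Set) → (∀ a b → P a b → uncurry Q (f (a , b))) → ∀ {i j} → Image f P i j → Q i j
Image-elim Q h (a , b , p , e) = subst (uncurry Q) e (h a b p)

Image-cong : ∀ f {P Q : ℕ → ℕ → Set} → (∀ a b → P a b ⇔ Q a b) → ∀ i j → Image f P i j ⇔ Image f Q i j
Image-cong f P⇔Q i j = mk⇔ (λ (a , b , p , e) → a , b , Equivalence.to (P⇔Q a b) p , e)
                           (λ (a , b , q , e) → a , b , Equivalence.from (P⇔Q a b) q , e)

Image-⊎ : ∀ f {P Q : ℕ → ℕ → Set} i j → Image f (λ a b → P a b ⊎ Q a b) i j ⇔ (Image f P i j ⊎ Image f Q i j)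
Image-⊎ f i j = mk⇔ (λ { (a , b , inj₁ p , e) → inj₁ (a , b , p , e) ; (a , b , inj₂ q , e) → inj₂ (a , b , q , e) })
                    (λ { (inj₁ (a , b , p , e)) → a , b , inj₁ p , e ; (inj₂ (a , b , q , e)) → a , b , inj₂ q , e })

Image-∘ : ∀ g f {P : ℕ → ℕ → Set} i j → Image g (Image f P) i j ⇔ Image (g ∘ f) P i j
Image-∘ g f i j = mk⇔ (λ (a , b , (a₀ , b₀ , p , e₀) , e) → a₀ , b₀ , p , trans (cong g e₀) e)
                      (λ (a₀ , b₀ , p , e) → _ , _ , (a₀ , b₀ , p , refl) , e)

countB-++ : ∀ xs ys → countB (xs ++ ys) ≡ countB xs + countB ys
countB-++ []           ys = refl
countB-++ (true ∷ xs)  ys = cong suc (countB-++ xs ys)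
countB-++ (false ∷ xs) ys = countB-++ xs ys

countB-interval : ∀ (g : ℕ → Bool) a b → (∀ j → g j ≡ true ⇔ (a ≤ j × j < b)) →
                  ∀ N → countB (map g (upTo N)) ≡ (b ⊓ N) ∸ a
countB-interval g a b g⇔ zero = trans (sym (0∸n≡0 a)) (cong (_∸ a) (sym (⊓-zeroʳ b)))
countB-interval g a b g⇔ (suc N) = begin
  countB (map g (upTo (suc N)))            ≡⟨ cong (countB ∘ map g) (sym (upTo-∷ʳ N)) ⟩
  countB (map g (upTo N ++ [ N ]))         ≡⟨ cong countB (map-++ g (upTo N) [ N ]) ⟩
  countB (map g (upTo N) ++ [ g N ])       ≡⟨ countB-++ (map g (upTo N)) [ g N ] ⟩
  countB (map g (upTo N)) + countB [ g N ] ≡⟨ cong (_+ countB [ g N ]) (countB-interval g a b g⇔ N) ⟩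
  (b ⊓ N) ∸ a + countB [ g N ]             ≡⟨ lastStep (g N) refl ⟩
  (b ⊓ suc N) ∸ a                          ∎
  where
    open ≡-Reasoning
    lastStep : ∀ x → g N ≡ x → (b ⊓ N) ∸ a + countB [ x ] ≡ (b ⊓ suc N) ∸ a
    lastStep true gN with Equivalence.to (g⇔ N) gN
    ... | a≤N , N<b rewrite m≥n⇒m⊓n≡n (<⇒≤ N<b) | m≥n⇒m⊓n≡n N<b =
      trans (+-comm (N ∸ a) 1) (sym (+-∸-assoc 1 a≤N))
    lastStep false gN with N <? b | a ≤? N
    ... | no N≮b | _ rewrite m≤n⇒m⊓n≡m (≮⇒≥ N≮b) | m≤n⇒m⊓n≡m (m≤n⇒m≤1+n (≮⇒≥ N≮b)) = +-identityʳ _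
    ... | yes N<b | yes a≤N = contradiction (trans (sym (Equivalence.from (g⇔ N) (a≤N , N<b))) gN) true≢false
    ... | yes N<b | no a≰N rewrite m≥n⇒m⊓n≡n (<⇒≤ N<b) | m≥n⇒m⊓n≡n N<b
                             | m≤n⇒m∸n≡0 (<⇒≤ (≰⇒> a≰N)) | m≤n⇒m∸n≡0 (≰⇒> a≰N) = refl

ribbonCells : Tab → Bool → ℕ → ℕ → ℕ → ℕ → ℕ → ℕ → Bool
ribbonCells T ne sr pr pc sc i j = not ne ∧ (suc sr ≤ᵇ i) ∧ (i ≤ᵇ pr) ∧ (suc pc ≤ᵇ j) ∧ (j ≤ᵇ sc)
                                   ∧ not (isCell T i j) ∧ isCell T (i ∸ 1) (j ∸ 1)

addRibbon : Tab → Bool → ℕ → ℕ → ℕ → ℕ → Tab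
addRibbon T ne sr pr pc sc =
  mkTab (nrows T) (λ i → len T i + countB (map (ribbonCells T ne sr pr pc sc i) (upTo (suc sc)))) (pt T)

-- As in insertpoint: ne tells whether the edge lies Northeast of the special point (sr , sc),
-- and (pr , pc) is the new point.
module AddRibbon (T : Tab) (ne : Bool) (sr pr pc sc : ℕ) (PF : PointedFerrers T)
                 (pr<nrows : pr < nrows T) (pc<len : pc < len T pr) (sc<len : sc < len T sr) where

  open PointedFerrers PF

  ribbon : ℕ → ℕ → Bool
  ribbon = ribbonCells T ne sr pr pc sc

  T⁺ : Tab
  T⁺ = addRibbon T ne sr pr pc sc

  len⁺ : ℕ → ℕ
  len⁺ i = len T i + countB (map (ribbon i) (upTo (suc sc)))

  RibbonRow : ℕ → Set
  RibbonRow i = ne ≡ false × sr < i × i ≤ pr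

  ribbonRow? : ∀ i → Dec (RibbonRow i)
  ribbonRow? i = (ne ≟𝔹 false) ×-dec (sr <? i) ×-dec (i ≤? pr)

  ribbonEnd : ℕ → ℕ
  ribbonEnd i = suc (sc ⊓ len T (i ∸ 1))

  ribbon⇒ : ∀ i j → ribbon i j ≡ true →
            RibbonRow i × pc < j × j ≤ sc × len T i ≤ j × j ∸ 1 < len T (i ∸ 1)
  ribbon⇒ i j r =
    let (a , r) = ∧≡true⇒× {not ne} r
        (b , r) = ∧≡true⇒× {suc sr ≤ᵇ i} r
        (c , r) = ∧≡true⇒× {i ≤ᵇ pr} r
        (d , r) = ∧≡true⇒× {suc pc ≤ᵇ j} r
        (e , r) = ∧≡true⇒× {j ≤ᵇ sc} r
        (f , g) = ∧≡true⇒× {not (isCell T i j)} r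
    in (not-injective a , ≤ᵇ≡true⇒≤ b , ≤ᵇ≡true⇒≤ c) , ≤ᵇ≡true⇒≤ d , ≤ᵇ≡true⇒≤ e
       , <ᵇ≡false⇒≥ (not-injective f) , <ᵇ≡true⇒< g

  ribbon⇐ : ∀ i j → RibbonRow i → pc < j → j ≤ sc → len T i ≤ j → j ∸ 1 < len T (i ∸ 1) → ribbon i j ≡ true
  ribbon⇐ i j (ne≡false , sr<i , i≤pr) pc<j j≤sc len≤j j-1<len =
    cong₂ _∧_ (cong not ne≡false) (cong₂ _∧_ (≤⇒≤ᵇ≡true sr<i) (cong₂ _∧_ (≤⇒≤ᵇ≡true i≤pr)
      (cong₂ _∧_ (≤⇒≤ᵇ≡true pc<j) (cong₂ _∧_ (≤⇒≤ᵇ≡true j≤sc)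
        (cong₂ _∧_ (cong not (≥⇒<ᵇ≡false len≤j)) (<⇒<ᵇ≡true j-1<len))))))

  pc<len-above : ∀ i → i ≤ pr → pc < len T i
  pc<len-above i i≤pr = <-≤-trans pc<len (rowsAntitone i≤pr)

  ribbon-inRow : ∀ i → RibbonRow i → ∀ j → ribbon i j ≡ true ⇔ (len T i ≤ j × j < ribbonEnd i)
  ribbon-inRow i R j = mk⇔ (to j) (λ (len≤j , j<end) → from j len≤j j<end)
    where
      pc<lenᵢ : pc < len T i
      pc<lenᵢ = pc<len-above i (proj₂ (proj₂ R))
      to : ∀ j → ribbon i j ≡ true → len T i ≤ j × j < ribbonEnd i
      to zero r with () ← proj₁ (proj₂ (ribbon⇒ i zero r))
      to (suc j) r = let (_ , _ , j<sc , len≤j , j<len) = ribbon⇒ i (suc j) r in len≤j , s≤s (⊓-glb j<sc j<len)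
      from : ∀ j → len T i ≤ j → j < ribbonEnd i → ribbon i j ≡ true
      from zero len≤0 _ with () ← <-≤-trans pc<lenᵢ len≤0
      from (suc j) len≤j (s≤s j<end) =
        ribbon⇐ i (suc j) R (<-≤-trans pc<lenᵢ len≤j) (≤-trans j<end (m⊓n≤m _ _)) len≤j (≤-trans j<end (m⊓n≤n _ _))

  ribbon-outsideRows : ∀ i → ¬ RibbonRow i → ∀ j → ribbon i j ≡ true ⇔ (0 ≤ j × j < 0)
  ribbon-outsideRows i ¬R j = mk⇔ (λ r → contradiction (proj₁ (ribbon⇒ i j r)) ¬R) (λ ())

  len-ribbonRow : ∀ i → RibbonRow i → len T⁺ i ≡ len T i ⊔ ribbonEnd i
  len-ribbonRow i R = begin
    len T⁺ i
      ≡⟨ len-mkTab (nrows T) len⁺ (pt T) i (≤-<-trans (proj₂ (proj₂ R)) pr<nrows) ⟩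
    len T i + countB (map (ribbon i) (upTo (suc sc)))
      ≡⟨ cong (len T i +_) (countB-interval (ribbon i) (len T i) (ribbonEnd i) (ribbon-inRow i R) (suc sc)) ⟩
    len T i + (ribbonEnd i ⊓ suc sc ∸ len T i)
      ≡⟨ cong (λ x → len T i + (x ∸ len T i)) (m≤n⇒m⊓n≡m (s≤s (m⊓n≤m sc _))) ⟩
    len T i + (ribbonEnd i ∸ len T i)
      ≡⟨ m+[n∸m]≡m⊔n (len T i) (ribbonEnd i) ⟩
    len T i ⊔ ribbonEnd i ∎
    where open ≡-Reasoning

  len-otherRow : ∀ i → ¬ RibbonRow i → len T⁺ i ≡ len T i
  len-otherRow i ¬R with i <? nrows T
  ... | yes i<n = begin
    len T⁺ i                                          ≡⟨ len-mkTab (nrows T) len⁺ (pt T) i i<n ⟩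
    len T i + countB (map (ribbon i) (upTo (suc sc))) ≡⟨ cong (len T i +_) (countB-interval (ribbon i) 0 0 (ribbon-outsideRows i ¬R) (suc sc)) ⟩
    len T i + 0                                       ≡⟨ +-identityʳ _ ⟩
    len T i                                           ∎
    where open ≡-Reasoning
  ... | no i≮n = trans (len-mkTab-≥ (nrows T) len⁺ (pt T) i (≮⇒≥ i≮n)) (sym (len-≥nrows T i (≮⇒≥ i≮n)))

  len≤len⁺ : ∀ i → len T i ≤ len T⁺ i
  len≤len⁺ i with ribbonRow? i
  ... | yes R = ≤-trans (m≤m⊔n _ _) (≤-reflexive (sym (len-ribbonRow i R)))
  ... | no ¬R = ≤-reflexive (sym (len-otherRow i ¬R))

  samePoints : ∀ i j → pt T⁺ i j ≡ pt T i j
  samePoints i j = pt-mkTab-≡ (nrows T) len⁺ (pt T) i j refl λ e →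
    pt⇒<nrows T i j e , <-≤-trans (pt⇒<len T i j e) (m≤m+n _ _)

  pointAbove⁺ : ∀ i j → PointAbove T⁺ i j ⇔ PointAbove T i j
  pointAbove⁺ i j = PointAbove-cong T T⁺ λ a _ → samePoints a j

  pointLeft⁺ : ∀ i j → PointLeft T⁺ i j ⇔ PointLeft T i j
  pointLeft⁺ i j = PointLeft-cong T T⁺ λ b _ → samePoints i b

  <len⁺⇒ : ∀ i j → j < len T⁺ i → j < len T i ⊎ ribbon i j ≡ true
  <len⁺⇒ i j j<len⁺ with ribbonRow? i
  ... | no ¬R = inj₁ (subst (j <_) (len-otherRow i ¬R) j<len⁺)
  ... | yes R with <⊔⇒<⊎≤∧< (subst (j <_) (len-ribbonRow i R) j<len⁺)
  ...   | inj₁ j<len = inj₁ j<len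
  ...   | inj₂ inRib = inj₂ (Equivalence.from (ribbon-inRow i R j) inRib)

  ribbon⇒<len⁺ : ∀ i j → ribbon i j ≡ true → j < len T⁺ i
  ribbon⇒<len⁺ i j r =
    let R = proj₁ (ribbon⇒ i j r)
        j<end = proj₂ (Equivalence.to (ribbon-inRow i R j) r)
    in subst (j <_) (sym (len-ribbonRow i R)) (<-≤-trans j<end (m≤n⊔m _ _))

  ribbonEnd≤len⁺ : ∀ i → RibbonRow (suc i) → ribbonEnd (suc i) ≤ len T⁺ i
  ribbonEnd≤len⁺ i R with sc <? len T i
  ... | yes sc<len = ≤-trans (s≤s (m⊓n≤m sc _)) (≤-trans sc<len (len≤len⁺ i))
  ribbonEnd≤len⁺ i (ne≡false , sr≤i , i<pr) | no sc≮len with sr ≟ i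
  ...   | yes refl = contradiction sc<len sc≮len
  ...   | no sr≢i = begin
    suc (sc ⊓ len T i)     ≤⟨ s≤s (⊓-monoʳ-≤ sc (rowsAntitone (m∸n≤m i 1))) ⟩
    ribbonEnd i            ≤⟨ m≤n⊔m _ _ ⟩
    len T i ⊔ ribbonEnd i  ≡⟨ len-ribbonRow i (ne≡false , ≤∧≢⇒< (≤-pred sr≤i) sr≢i , ≤-trans (n≤1+n i) i<pr) ⟨
    len T⁺ i               ∎
    where open ≤-Reasoning

  rowsDecrease⁺ : RowsDecrease T⁺
  rowsDecrease⁺ i with ribbonRow? (suc i)
  ... | no ¬R = subst (_≤ len T⁺ i) (sym (len-otherRow (suc i) ¬R)) (≤-trans (rowsDecrease i) (len≤len⁺ i))
  ... | yes R = subst (_≤ len T⁺ i) (sym (len-ribbonRow (suc i) R))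
                      (⊔-lub (≤-trans (rowsDecrease i) (len≤len⁺ i)) (ribbonEnd≤len⁺ i R))

  pointedFerrers⁺ : PointedFerrers T⁺
  pointedFerrers⁺ = record
    { rowsDecrease = rowsDecrease⁺
    ; rowPoint     = λ i i<n → let (j , e) = rowPoint i (subst (i <_) (nrows-mkTab (nrows T) len⁺ (pt T)) i<n)
                               in j , trans (samePoints i j) e
    ; columnPoint  = λ j j<len → let (i , e) = columnPoint j (subst (j <_) (len-otherRow 0 λ ()) j<len)
                                 in i , trans (samePoints i j) e
    }

  -- The point of column j lies above row i since rows i, i+1, … of T do not reach column j; the
  -- point of row i lies to its left since the ribbon cell is beyond the end of row i in T.
  ribbon⇒crossing⁺ : ∀ i j → ribbon i j ≡ true → Crossing T⁺ i j
  ribbon⇒crossing⁺ i j r = <⇒<ᵇ≡true (ribbon⇒<len⁺ i j r) , trans (samePoints i j) (len≤⇒¬pt T i j len≤j)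
                         , Equivalence.from (pointAbove⁺ i j) above
                         , Equivalence.from (pointLeft⁺ i j) left
    where
      R     = proj₁ (ribbon⇒ i j r)
      j≤sc  = proj₁ (proj₂ (proj₂ (ribbon⇒ i j r)))
      len≤j = proj₁ (proj₂ (proj₂ (proj₂ (ribbon⇒ i j r))))
      above : PointAbove T i j
      above with columnPoint j (<-≤-trans (s≤s j≤sc) (<-≤-trans sc<len (rowsAntitone z≤n)))
      ... | a , e with a <? i
      ...   | yes a<i = a , a<i , e
      ...   | no a≮i  = contradiction (pt⇒<len T a j e) (≤⇒≯ (≤-trans (rowsAntitone (≮⇒≥ a≮i)) len≤j))
      left : PointLeft T i j
      left = let (b , e) = rowPoint i (≤-<-trans (proj₂ (proj₂ R)) pr<nrows)
             in b , <-≤-trans (pt⇒<len T i b e) len≤j , e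

  crossing⁺ : ∀ i j → Crossing T⁺ i j ⇔ (Crossing T i j ⊎ ribbon i j ≡ true)
  crossing⁺ i j = mk⇔ to from
    where
      to : Crossing T⁺ i j → Crossing T i j ⊎ ribbon i j ≡ true
      to (cell , empty , above , left) with <len⁺⇒ i j (<ᵇ≡true⇒< cell)
      ... | inj₂ r     = inj₂ r
      ... | inj₁ j<len = inj₁ (<⇒<ᵇ≡true j<len , trans (sym (samePoints i j)) empty
                              , Equivalence.to (pointAbove⁺ i j) above
                              , Equivalence.to (pointLeft⁺ i j) left)
      from : Crossing T i j ⊎ ribbon i j ≡ true → Crossing T⁺ i j
      from (inj₂ r) = ribbon⇒crossing⁺ i j r
      from (inj₁ (cell , empty , above , left)) =
        <⇒<ᵇ≡true (<-≤-trans (<ᵇ≡true⇒< cell) (len≤len⁺ i)) , trans (samePoints i j) empty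
        , Equivalence.from (pointAbove⁺ i j) above
        , Equivalence.from (pointLeft⁺ i j) left

module InsertColumn (T : Tab) (PF : PointedFerrers T) (r : ℕ) (r<nrows : r < nrows T) where

  open PointedFerrers PF

  L : ℕ
  L = len T r

  l' : ℕ → ℕ
  l' i = if i ≤ᵇ r then suc (len T i) else len T i

  p' : ℕ → ℕ → Bool
  p' i j = if j <ᵇ L then pt T i j else (if j ≡ᵇ L then i ≡ᵇ r else pt T i (j ∸ 1))

  emb : ℕ × ℕ → ℕ × ℕ
  emb (i , j) = (i , (if j <ᵇ L then j else suc j))

  T' : Tab
  T' = mkTab (nrows T) l' p'

  len-below : ∀ i → r < i → len T i ≤ L
  len-below i r<i = rowsAntitone (<⇒≤ r<i)

  l'-≤r : ∀ i → i ≤ r → l' i ≡ suc (len T i)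
  l'-≤r i i≤r rewrite ≤⇒≤ᵇ≡true i≤r = refl

  l'->r : ∀ i → r < i → l' i ≡ len T i
  l'->r i r<i rewrite >⇒≤ᵇ≡false r<i = refl

  len'-≤r : ∀ i → i ≤ r → len T' i ≡ suc (len T i)
  len'-≤r i i≤r = trans (len-mkTab (nrows T) l' p' i (≤-<-trans i≤r r<nrows)) (l'-≤r i i≤r)

  len'->r : ∀ i → r < i → len T' i ≡ len T i
  len'->r i r<i with i <? nrows T
  ... | yes i<n = trans (len-mkTab (nrows T) l' p' i i<n) (l'->r i r<i)
  ... | no i≮n  = trans (len-mkTab-≥ (nrows T) l' p' i (≮⇒≥ i≮n)) (sym (len-≥nrows T i (≮⇒≥ i≮n)))

  len≤len' : ∀ i → len T i ≤ len T' i
  len≤len' i with i ≤? r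
  ... | yes i≤r = ≤-trans (n≤1+n _) (≤-reflexive (sym (len'-≤r i i≤r)))
  ... | no i≰r  = ≤-reflexive (sym (len'->r i (≰⇒> i≰r)))

  pt'-before : ∀ i j → j < L → pt T' i j ≡ pt T i j
  pt'-before i j j<L = pt-mkTab-≡ (nrows T) l' p' i j p'≡ λ e →
      pt⇒<nrows T i j e , <-≤-trans (pt⇒<len T i j e) (≤-trans (len≤len' i) (≤-reflexive (len-mkTab (nrows T) l' p' i (pt⇒<nrows T i j e))))
    where
      p'≡ : p' i j ≡ pt T i j
      p'≡ rewrite <⇒<ᵇ≡true j<L = refl

  pt'-on : ∀ i → pt T' i L ≡ (i ≡ᵇ r)
  pt'-on i = pt-mkTab-≡ (nrows T) l' p' i L p'≡ λ e →
      let i≡r = ≡ᵇ≡true⇒≡ e in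
      subst (_< nrows T) (sym i≡r) r<nrows , subst (λ x → L < l' x) (sym i≡r) (≤-reflexive (sym (l'-≤r r ≤-refl)))
    where
      p'≡ : p' i L ≡ (i ≡ᵇ r)
      p'≡ rewrite ≥⇒<ᵇ≡false (≤-refl {L}) | ≡⇒≡ᵇ≡true (refl {x = L}) = refl

  pt'-after : ∀ i j → L ≤ j → pt T' i (suc j) ≡ pt T i j
  pt'-after i j L≤j = pt-mkTab-≡ (nrows T) l' p' i (suc j) p'≡ λ e →
      pt⇒<nrows T i j e , subst (suc j <_) (sym (l'-≤r i (i≤r e))) (s≤s (pt⇒<len T i j e))
    where
      p'≡ : p' i (suc j) ≡ pt T i j
      p'≡ rewrite ≥⇒<ᵇ≡false (m≤n⇒m≤1+n L≤j) | ≢⇒≡ᵇ≡false {suc j} {L} (≢-sym (<⇒≢ (s≤s L≤j))) = refl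
      i≤r : pt T i j ≡ true → i ≤ r
      i≤r e with i ≤? r
      ... | yes i≤r = i≤r
      ... | no i≰r  = contradiction (pt⇒<len T i j e) (≤⇒≯ (≤-trans (len-below i (≰⇒> i≰r)) L≤j))

  isCell'-before : ∀ i j → j < L → isCell T' i j ≡ isCell T i j
  isCell'-before i j j<L with i ≤? r
  ... | yes i≤r = let j<len = <-≤-trans j<L (rowsAntitone i≤r) in
                  trans (<⇒<ᵇ≡true (<-≤-trans j<len (len≤len' i))) (sym (<⇒<ᵇ≡true j<len))
  ... | no i≰r  = cong (j <ᵇ_) (len'->r i (≰⇒> i≰r))

  isCell'-after : ∀ i j → L ≤ j → isCell T' i (suc j) ≡ isCell T i j
  isCell'-after i j L≤j with i ≤? r
  ... | yes i≤r = cong (suc j <ᵇ_) (len'-≤r i i≤r)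
  ... | no i≰r  = let len≤L = len-below i (≰⇒> i≰r) in
                  trans (≥⇒<ᵇ≡false (≤-trans (≤-reflexive (len'->r i (≰⇒> i≰r))) (≤-trans len≤L (m≤n⇒m≤1+n L≤j))))
                        (sym (≥⇒<ᵇ≡false (≤-trans len≤L L≤j)))

  pointLeft-after : ∀ i j → L ≤ j → PointLeft T' i (suc j) ⇔ PointLeft T i j
  pointLeft-after i j L≤j = mk⇔ to from
    where
      to : PointLeft T' i (suc j) → PointLeft T i j
      to (b , b<1+j , e) with position L b
      ... | before b<L = b , <-≤-trans b<L L≤j , trans (sym (pt'-before i b b<L)) e
      ... | after {b₀} L≤b₀ = b₀ , ≤-pred b<1+j , trans (sym (pt'-after i b₀ L≤b₀)) e
      ... | on = let i≡r = ≡ᵇ≡true⇒≡ (trans (sym (pt'-on i)) e)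
                     (b' , e') = rowPoint r r<nrows
                 in b' , <-≤-trans (pt⇒<len T r b' e') L≤j , subst (λ x → pt T x b' ≡ true) (sym i≡r) e'
      from : PointLeft T i j → PointLeft T' i (suc j)
      from (b , b<j , e) with b <? L
      ... | yes b<L = b , m<n⇒m<1+n b<j , trans (pt'-before i b b<L) e
      ... | no b≮L  = suc b , s≤s b<j , trans (pt'-after i b (≮⇒≥ b≮L)) e

  crossing-before : ∀ i j → j < L → Crossing T' i j ⇔ Crossing T i j
  crossing-before i j j<L =
    Crossing-cong T T' (isCell'-before i j j<L) (pt'-before i j j<L)
      (PointAbove-cong T T' λ a _ → pt'-before a j j<L)
      (PointLeft-cong T T' λ b b<j → pt'-before i b (<-trans b<j j<L))

  crossing-after : ∀ i j → L ≤ j → Crossing T' i (suc j) ⇔ Crossing T i j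
  crossing-after i j L≤j =
    Crossing-cong T T' (isCell'-after i j L≤j) (pt'-after i j L≤j)
      (PointAbove-cong T T' λ a _ → pt'-after a j L≤j) (pointLeft-after i j L≤j)

  ¬crossing-on : ∀ i → ¬ Crossing T' i L
  ¬crossing-on i (cell , _ , (a , a<i , e) , _) =
    let r<i = subst (_< i) (≡ᵇ≡true⇒≡ (trans (sym (pt'-on a)) e)) a<i
    in contradiction (<ᵇ≡true⇒< cell) (≤⇒≯ (≤-trans (≤-reflexive (len'->r i r<i)) (len-below i r<i)))

  emb-before : ∀ a b → b < L → emb (a , b) ≡ (a , b)
  emb-before a b b<L rewrite <⇒<ᵇ≡true b<L = refl

  emb-after : ∀ a b → L ≤ b → emb (a , b) ≡ (a , suc b)
  emb-after a b L≤b rewrite ≥⇒<ᵇ≡false L≤b = refl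

  crossing' : ∀ i j → Crossing T' i j ⇔ Image emb (Crossing T) i j
  crossing' i j = mk⇔ (to j) (Image-elim (Crossing T') from)
    where
      to : ∀ j → Crossing T' i j → Image emb (Crossing T) i j
      to j c with position L j
      ... | before j<L      = i , j , Equivalence.to (crossing-before i j j<L) c , emb-before i j j<L
      ... | on              = contradiction c (¬crossing-on i)
      ... | after {j₀} L≤j₀ = i , j₀ , Equivalence.to (crossing-after i j₀ L≤j₀) c , emb-after i j₀ L≤j₀
      from : ∀ a b → Crossing T a b → uncurry (Crossing T') (emb (a , b))
      from a b c with b <? L
      ... | yes b<L = subst (uncurry (Crossing T')) (sym (emb-before a b b<L))
                            (Equivalence.from (crossing-before a b b<L) c)
      ... | no b≮L  = subst (uncurry (Crossing T')) (sym (emb-after a b (≮⇒≥ b≮L)))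
                            (Equivalence.from (crossing-after a b (≮⇒≥ b≮L)) c)

  rowsDecrease' : RowsDecrease T'
  rowsDecrease' i with suc i ≤? r | i ≤? r
  ... | yes 1+i≤r | _ = subst₂ _≤_ (sym (len'-≤r (suc i) 1+i≤r)) (sym (len'-≤r i (≤-trans (n≤1+n i) 1+i≤r)))
                                (s≤s (rowsDecrease i))
  ... | no 1+i≰r | yes i≤r = subst₂ _≤_ (sym (len'->r (suc i) (≰⇒> 1+i≰r))) (sym (len'-≤r i i≤r))
                                     (m≤n⇒m≤1+n (rowsDecrease i))
  ... | no 1+i≰r | no i≰r  = subst₂ _≤_ (sym (len'->r (suc i) (≰⇒> 1+i≰r))) (sym (len'->r i (≰⇒> i≰r)))
                                     (rowsDecrease i)

  pointedFerrers' : PointedFerrers T'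
  pointedFerrers' = record { rowsDecrease = rowsDecrease' ; rowPoint = rowPoint' ; columnPoint = columnPoint' }
    where
      rowPoint' : ∀ i → i < nrows T' → Σ ℕ λ j → pt T' i j ≡ true
      rowPoint' i i<n with rowPoint i (subst (i <_) (nrows-mkTab (nrows T) l' p') i<n)
      ... | j , e with j <? L
      ...   | yes j<L = j , trans (pt'-before i j j<L) e
      ...   | no j≮L  = suc j , trans (pt'-after i j (≮⇒≥ j≮L)) e
      columnPoint' : ∀ j → j < len T' 0 → Σ ℕ λ i → pt T' i j ≡ true
      columnPoint' j j<len with position L j
      ... | before j<L = let (a , e) = columnPoint j (<-≤-trans j<L (rowsAntitone z≤n)) in a , trans (pt'-before a j j<L) e
      ... | on = r , trans (pt'-on r) (≡⇒≡ᵇ≡true {r} refl)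
      ... | after {j₀} L≤j₀ = let (a , e) = columnPoint j₀ (≤-pred (subst (suc j₀ <_) (len'-≤r 0 z≤n) j<len))
                              in a , trans (pt'-after a j₀ L≤j₀) e

  r<nrows' : r < nrows T'
  r<nrows' = subst (r <_) (sym (nrows-mkTab (nrows T) l' p')) r<nrows

  L<len' : L < len T' r
  L<len' = subst (L <_) (sym (len'-≤r r ≤-refl)) ≤-refl

  emb-cell : ∀ a b → b < len T a → proj₂ (emb (a , b)) < len T' (proj₁ (emb (a , b)))
  emb-cell a b b<len with b <? L
  ... | yes b<L = subst (λ x → proj₂ x < len T' (proj₁ x)) (sym (emb-before a b b<L)) (<-≤-trans b<len (len≤len' a))
  ... | no b≮L  = subst (λ x → proj₂ x < len T' (proj₁ x)) (sym (emb-after a b (≮⇒≥ b≮L)))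
                        (subst (suc b <_) (sym (len'-≤r a a≤r)) (s≤s b<len))
    where
      a≤r : a ≤ r
      a≤r with a ≤? r
      ... | yes a≤r = a≤r
      ... | no a≰r  = contradiction b<len (≤⇒≯ (≤-trans (len-below a (≰⇒> a≰r)) (≮⇒≥ b≮L)))

colHeight-spec : ∀ T c → RowsDecrease T →
                 (∀ i → i < colHeight T c → c < len T i) × (∀ i → colHeight T c ≤ i → len T i ≤ c)
colHeight-spec []       c dec = (λ _ ()) , (λ _ _ → z≤n)
colHeight-spec (x ∷ xs) c dec with colHeight-spec xs c (dec ∘ suc) | c <ᵇ length x in eq
... | (inside , outside) | true = inside' , outside'
  where
    inside' : ∀ i → i < suc (colHeight xs c) → c < len (x ∷ xs) i
    inside' zero    _         = <ᵇ≡true⇒< eq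
    inside' (suc i) (s≤s i<h) = inside i i<h
    outside' : ∀ i → suc (colHeight xs c) ≤ i → len (x ∷ xs) i ≤ c
    outside' (suc i) (s≤s h≤i) = outside i h≤i
... | (inside , outside) | false = inside' , outside'
  where
    outside' : ∀ i → colHeight xs c ≤ i → len (x ∷ xs) i ≤ c
    outside' i _ = ≤-trans (len-antitone (x ∷ xs) dec (z≤n {i})) (<ᵇ≡false⇒≥ eq)
    inside' : ∀ i → i < colHeight xs c → c < len (x ∷ xs) i
    inside' i i<h = contradiction (inside 0 (≤-<-trans z≤n i<h)) (≤⇒≯ (≤-trans (dec 0) (<ᵇ≡false⇒≥ eq)))

module InsertRow (T : Tab) (PF : PointedFerrers T) (c r : ℕ) (r<nrows : r < nrows T)
                 (len≤c : len T (suc r) ≤ c) (c<len : c < len T r) where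

  open PointedFerrers PF

  H : ℕ
  H = colHeight T c

  l' : ℕ → ℕ
  l' i = if i <ᵇ H then len T i else (if i ≡ᵇ H then suc c else len T (i ∸ 1))

  p' : ℕ → ℕ → Bool
  p' i j = if i <ᵇ H then pt T i j else (if i ≡ᵇ H then j ≡ᵇ c else pt T (i ∸ 1) j)

  emb : ℕ × ℕ → ℕ × ℕ
  emb (i , j) = ((if i <ᵇ H then i else suc i) , j)

  T' : Tab
  T' = mkTab (suc (nrows T)) l' p'

  <H⇒c<len : ∀ i → i < H → c < len T i
  <H⇒c<len = proj₁ (colHeight-spec T c rowsDecrease)

  H≤⇒len≤c : ∀ i → H ≤ i → len T i ≤ c
  H≤⇒len≤c = proj₂ (colHeight-spec T c rowsDecrease)

  r<H : r < H
  r<H with r <? H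
  ... | yes r<H = r<H
  ... | no r≮H  = contradiction c<len (≤⇒≯ (H≤⇒len≤c r (≮⇒≥ r≮H)))

  H≤nrows : H ≤ nrows T
  H≤nrows with H ≤? suc r
  ... | yes H≤1+r = ≤-trans H≤1+r r<nrows
  ... | no H≰1+r  = contradiction (<H⇒c<len (suc r) (≰⇒> H≰1+r)) (≤⇒≯ len≤c)

  l'-before : ∀ i → i < H → l' i ≡ len T i
  l'-before i i<H rewrite <⇒<ᵇ≡true i<H = refl

  l'-on : l' H ≡ suc c
  l'-on rewrite ≥⇒<ᵇ≡false (≤-refl {H}) | ≡⇒≡ᵇ≡true (refl {x = H}) = refl

  l'-after : ∀ i → H ≤ i → l' (suc i) ≡ len T i
  l'-after i H≤i rewrite ≥⇒<ᵇ≡false (m≤n⇒m≤1+n H≤i) | ≢⇒≡ᵇ≡false {suc i} {H} (≢-sym (<⇒≢ (s≤s H≤i))) = refl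

  len'-before : ∀ i → i < H → len T' i ≡ len T i
  len'-before i i<H = trans (len-mkTab (suc (nrows T)) l' p' i (≤-trans (m≤n⇒m≤1+n i<H) (s≤s H≤nrows))) (l'-before i i<H)

  len'-on : len T' H ≡ suc c
  len'-on = trans (len-mkTab (suc (nrows T)) l' p' H (s≤s H≤nrows)) l'-on

  len'-after : ∀ i → H ≤ i → len T' (suc i) ≡ len T i
  len'-after i H≤i with i <? nrows T
  ... | yes i<n = trans (len-mkTab (suc (nrows T)) l' p' (suc i) (s≤s i<n)) (l'-after i H≤i)
  ... | no i≮n  = trans (len-mkTab-≥ (suc (nrows T)) l' p' (suc i) (s≤s (≮⇒≥ i≮n))) (sym (len-≥nrows T i (≮⇒≥ i≮n)))

  pt'-before : ∀ i j → i < H → pt T' i j ≡ pt T i j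
  pt'-before i j i<H = pt-mkTab-≡ (suc (nrows T)) l' p' i j p'≡ λ e →
      ≤-trans (m≤n⇒m≤1+n i<H) (s≤s H≤nrows) , subst (j <_) (sym (l'-before i i<H)) (pt⇒<len T i j e)
    where
      p'≡ : p' i j ≡ pt T i j
      p'≡ rewrite <⇒<ᵇ≡true i<H = refl

  pt'-on : ∀ j → pt T' H j ≡ (j ≡ᵇ c)
  pt'-on j = pt-mkTab-≡ (suc (nrows T)) l' p' H j p'≡ λ e →
      s≤s H≤nrows , subst (j <_) (sym l'-on) (s≤s (≤-reflexive (≡ᵇ≡true⇒≡ e)))
    where
      p'≡ : p' H j ≡ (j ≡ᵇ c)
      p'≡ rewrite ≥⇒<ᵇ≡false (≤-refl {H}) | ≡⇒≡ᵇ≡true (refl {x = H}) = refl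

  pt'-after : ∀ i j → H ≤ i → pt T' (suc i) j ≡ pt T i j
  pt'-after i j H≤i = pt-mkTab-≡ (suc (nrows T)) l' p' (suc i) j p'≡ λ e →
      s≤s (pt⇒<nrows T i j e) , subst (j <_) (sym (l'-after i H≤i)) (pt⇒<len T i j e)
    where
      p'≡ : p' (suc i) j ≡ pt T i j
      p'≡ rewrite ≥⇒<ᵇ≡false (m≤n⇒m≤1+n H≤i) | ≢⇒≡ᵇ≡false {suc i} {H} (≢-sym (<⇒≢ (s≤s H≤i))) = refl

  pointAbove-after : ∀ i j → H ≤ i → PointAbove T' (suc i) j ⇔ PointAbove T i j
  pointAbove-after i j H≤i = mk⇔ to from
    where
      to : PointAbove T' (suc i) j → PointAbove T i j
      to (a , a<1+i , e) with position H a
      ... | before a<H = a , <-≤-trans a<H H≤i , trans (sym (pt'-before a j a<H)) e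
      ... | after {a₀} H≤a₀ = a₀ , ≤-pred a<1+i , trans (sym (pt'-after a₀ j H≤a₀)) e
      ... | on = let j≡c = ≡ᵇ≡true⇒≡ (trans (sym (pt'-on j)) e)
                     (a' , e') = columnPoint c (<-≤-trans c<len (rowsAntitone z≤n))
                     a'<H = ≰⇒> λ H≤a' → contradiction (pt⇒<len T a' c e') (≤⇒≯ (H≤⇒len≤c a' H≤a'))
                 in a' , <-≤-trans a'<H H≤i , subst (λ x → pt T a' x ≡ true) (sym j≡c) e'
      from : PointAbove T i j → PointAbove T' (suc i) j
      from (a , a<i , e) with a <? H
      ... | yes a<H = a , m<n⇒m<1+n a<i , trans (pt'-before a j a<H) e
      ... | no a≮H  = suc a , s≤s a<i , trans (pt'-after a j (≮⇒≥ a≮H)) e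

  crossing-before : ∀ i j → i < H → Crossing T' i j ⇔ Crossing T i j
  crossing-before i j i<H =
    Crossing-cong T T' (cong (j <ᵇ_) (len'-before i i<H)) (pt'-before i j i<H)
      (PointAbove-cong T T' λ a a<i → pt'-before a j (<-trans a<i i<H))
      (PointLeft-cong T T' {i} {i} λ b _ → pt'-before i b i<H)

  crossing-after : ∀ i j → H ≤ i → Crossing T' (suc i) j ⇔ Crossing T i j
  crossing-after i j H≤i =
    Crossing-cong T T' (cong (j <ᵇ_) (len'-after i H≤i)) (pt'-after i j H≤i)
      (pointAbove-after i j H≤i) (PointLeft-cong T T' {i} {suc i} λ b _ → pt'-after i b H≤i)

  ¬crossing-on : ∀ j → ¬ Crossing T' H j
  ¬crossing-on j (cell , _ , _ , (b , b<j , e)) =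
    let c<j = subst (_< j) (≡ᵇ≡true⇒≡ (trans (sym (pt'-on b)) e)) b<j
    in contradiction (subst (j <_) len'-on (<ᵇ≡true⇒< cell)) (≤⇒≯ c<j)

  emb-before : ∀ a b → a < H → emb (a , b) ≡ (a , b)
  emb-before a b a<H rewrite <⇒<ᵇ≡true a<H = refl

  emb-after : ∀ a b → H ≤ a → emb (a , b) ≡ (suc a , b)
  emb-after a b H≤a rewrite ≥⇒<ᵇ≡false H≤a = refl

  crossing' : ∀ i j → Crossing T' i j ⇔ Image emb (Crossing T) i j
  crossing' i j = mk⇔ (to i) (Image-elim (Crossing T') from)
    where
      to : ∀ i → Crossing T' i j → Image emb (Crossing T) i j
      to i c with position H i
      ... | before i<H      = i , j , Equivalence.to (crossing-before i j i<H) c , emb-before i j i<H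
      ... | on              = contradiction c (¬crossing-on j)
      ... | after {i₀} H≤i₀ = i₀ , j , Equivalence.to (crossing-after i₀ j H≤i₀) c , emb-after i₀ j H≤i₀
      from : ∀ a b → Crossing T a b → uncurry (Crossing T') (emb (a , b))
      from a b c with a <? H
      ... | yes a<H = subst (uncurry (Crossing T')) (sym (emb-before a b a<H))
                            (Equivalence.from (crossing-before a b a<H) c)
      ... | no a≮H  = subst (uncurry (Crossing T')) (sym (emb-after a b (≮⇒≥ a≮H)))
                            (Equivalence.from (crossing-after a b (≮⇒≥ a≮H)) c)

  rowsDecrease' : RowsDecrease T'
  rowsDecrease' i with position H i
  rowsDecrease' i | before i<H with suc i <? H
  ... | yes 1+i<H = subst₂ _≤_ (sym (len'-before (suc i) 1+i<H)) (sym (len'-before i i<H)) (rowsDecrease i)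
  ... | no 1+i≮H  = subst₂ _≤_ (sym (trans (cong (len T') 1+i≡H) len'-on)) (sym (len'-before i i<H)) (<H⇒c<len i i<H)
    where
      1+i≡H : suc i ≡ H
      1+i≡H = ≤-antisym i<H (≮⇒≥ 1+i≮H)
  rowsDecrease' .H | on = subst₂ _≤_ (sym (len'-after H ≤-refl)) (sym len'-on) (m≤n⇒m≤1+n (H≤⇒len≤c H ≤-refl))
  rowsDecrease' .(suc i₀) | after {i₀} H≤i₀ =
    subst₂ _≤_ (sym (len'-after (suc i₀) (m≤n⇒m≤1+n H≤i₀))) (sym (len'-after i₀ H≤i₀)) (rowsDecrease i₀)

  pointedFerrers' : PointedFerrers T'
  pointedFerrers' = record { rowsDecrease = rowsDecrease' ; rowPoint = rowPoint' ; columnPoint = columnPoint' }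
    where
      rowPoint' : ∀ i → i < nrows T' → Σ ℕ λ j → pt T' i j ≡ true
      rowPoint' i i<n with position H i
      ... | before i<H = let (j , e) = rowPoint i (<-≤-trans i<H H≤nrows) in j , trans (pt'-before i j i<H) e
      ... | on = c , trans (pt'-on c) (≡⇒≡ᵇ≡true {c} refl)
      ... | after {i₀} H≤i₀ = let (j , e) = rowPoint i₀ (≤-pred (subst (suc i₀ <_) (nrows-mkTab (suc (nrows T)) l' p') i<n))
                              in j , trans (pt'-after i₀ j H≤i₀) e
      columnPoint' : ∀ j → j < len T' 0 → Σ ℕ λ i → pt T' i j ≡ true
      columnPoint' j j<len with columnPoint j (subst (j <_) (len'-before 0 (≤-<-trans z≤n r<H)) j<len)
      ... | a , e with a <? H
      ...   | yes a<H = a , trans (pt'-before a j a<H) e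
      ...   | no a≮H  = suc a , trans (pt'-after a j (≮⇒≥ a≮H)) e

  H<nrows' : H < nrows T'
  H<nrows' = subst (H <_) (sym (nrows-mkTab (suc (nrows T)) l' p')) (s≤s H≤nrows)

  c<len' : c < len T' H
  c<len' = subst (c <_) (sym len'-on) ≤-refl

  emb-cell : ∀ a b → b < len T a → proj₂ (emb (a , b)) < len T' (proj₁ (emb (a , b)))
  emb-cell a b b<len with a <? H
  ... | yes a<H = subst (λ x → proj₂ x < len T' (proj₁ x)) (sym (emb-before a b a<H))
                        (subst (b <_) (sym (len'-before a a<H)) b<len)
  ... | no a≮H  = subst (λ x → proj₂ x < len T' (proj₁ x)) (sym (emb-after a b (≮⇒≥ a≮H)))
                        (subst (b <_) (sym (len'-after a (≮⇒≥ a≮H))) b<len)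

data BoundaryEdge (T : Tab) : Edge → Set where
  rowEnd       : ∀ r → r < nrows T → BoundaryEdge T (rowN r)
  columnBottom : ∀ c r → r < nrows T → len T (suc r) ≤ c → c < len T r → BoundaryEdge T (colE c)

==E⇒≡ : ∀ e f → (e ==E f) ≡ true → e ≡ f
==E⇒≡ (colE a) (colE b) eq = cong colE (≡ᵇ≡true⇒≡ eq)
==E⇒≡ (rowN a) (rowN b) eq = cong rowN (≡ᵇ≡true⇒≡ eq)

indexOf<length⇒∈ : ∀ e es → indexOf e es < length es → e ∈ es
indexOf<length⇒∈ e (f ∷ fs) i< with e ==E f in eq
... | true  = here (==E⇒≡ e f eq)
... | false = there (indexOf<length⇒∈ e fs (≤-pred i<))

borderSegment : Tab → ℕ → List Edge
borderSegment T r = map colE (range (len T (suc r)) (len T r)) ++ [ rowN r ]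

borderSegment⇒BoundaryEdge : ∀ T r e → r < nrows T → e ∈ borderSegment T r → BoundaryEdge T e
borderSegment⇒BoundaryEdge T r e r<n e∈ with ∈-++⁻ (map colE (range (len T (suc r)) (len T r))) e∈
... | inj₂ (here refl) = rowEnd r r<n
... | inj₁ e∈cols with ∈-map⁻ colE e∈cols
...   | c , c∈ , refl with ∈-map⁻ (len T (suc r) +_) c∈
...     | k , k∈ , refl = columnBottom _ r r<n (m≤m+n _ _) (subst (len T (suc r) + k <_) (m+[n∸m]≡n below) (+-monoʳ-< _ k<))
  where
    k< : k < len T r ∸ len T (suc r)
    k< = ∈-upTo⁻ k∈
    below : len T (suc r) ≤ len T r
    below with len T (suc r) ≤? len T r
    ... | yes ≤len = ≤len
    ... | no ≰len  = contradiction k< (≤⇒≯ (subst (_≤ k) (sym (m≤n⇒m∸n≡0 (<⇒≤ (≰⇒> ≰len)))) z≤n))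

isBoundary⇒BoundaryEdge : ∀ T e → isBoundary T e ≡ true → BoundaryEdge T e
isBoundary⇒BoundaryEdge T e isB
  with find (∈-concatMap⁻ (borderSegment T) {xs = reverse (upTo (nrows T))}
                          (indexOf<length⇒∈ e (border T) (<ᵇ≡true⇒< isB)))
... | r , r∈ , e∈ = borderSegment⇒BoundaryEdge T r e (∈-upTo⁻ (reverse⁻ r∈)) e∈

foldl-selects : ∀ {A : Set} (g : Maybe A → A → Maybe A) → (∀ acc x → g acc x ≡ just x ⊎ g acc x ≡ acc) →
                ∀ xs acc {y} → foldl g acc xs ≡ just y → acc ≡ just y ⊎ y ∈ xs
foldl-selects g sel []       acc eq = inj₁ eq
foldl-selects g sel (x ∷ xs) acc eq with foldl-selects g sel xs (g acc x) eq
... | inj₂ y∈xs = inj₂ (there y∈xs)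
... | inj₁ g≡y with sel acc x
...   | inj₁ g≡x   = inj₂ (here (just-injective (trans (sym g≡y) g≡x)))
...   | inj₂ g≡acc = inj₁ (trans (sym g≡acc) g≡y)

specialCol<len : ∀ T {sc} → specialCol T ≡ just sc → sc < len T 0
specialCol<len T eq with foldl-selects _ select (upTo (len T 0)) nothing eq
  where
    select : ∀ acc c → (if pt T (colHeight T c ∸ 1) c then just c else acc) ≡ just c
                       ⊎ (if pt T (colHeight T c ∸ 1) c then just c else acc) ≡ acc
    select acc c with pt T (colHeight T c ∸ 1) c
    ... | true  = inj₁ refl
    ... | false = inj₂ refl
... | inj₂ sc∈ = ∈-upTo⁻ sc∈

bottomCell : ∀ T → RowsDecrease T → ∀ c → c < len T 0 → c < len T (colHeight T c ∸ 1)
bottomCell T dec c c<len with colHeight-spec T c dec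
... | inside , outside with colHeight T c
...   | zero  = contradiction c<len (≤⇒≯ (outside 0 z≤n))
...   | suc h = inside h ≤-refl

StepCrossings : Tab → Step → Set
StepCrossings T s = ∀ i j → Crossing (Step.tab s) i j ⇔ (Image (Step.emb s) (Crossing T) i j ⊎ Step.rib s i j ≡ true)

insert-then-addRibbon :
  ∀ T T' emb ne sr pr pc sc → PointedFerrers T' → pr < nrows T' → pc < len T' pr → sc < len T' sr →
  (∀ i j → Crossing T' i j ⇔ Image emb (Crossing T) i j) →
  PointedFerrers (addRibbon T' ne sr pr pc sc) ×
  StepCrossings T (step (addRibbon T' ne sr pr pc sc) emb (ribbonCells T' ne sr pr pc sc))
insert-then-addRibbon T T' emb ne sr pr pc sc PF' pr<n pc<len sc<len crossing' =
  pointedFerrers⁺ , λ i j → (crossing' i j ⊎-⇔ ⇔-id _) ⇔-∘ crossing⁺ i j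
  where open AddRibbon T' ne sr pr pc sc PF' pr<n pc<len sc<len

-- The matches against refl succeed because InsertColumn, InsertRow and addRibbon rebuild
-- insertpoint's tableaux definitionally.
insertpoint-step : ∀ T e s → PointedFerrers T → insertpoint T e ≡ just s →
                   PointedFerrers (Step.tab s) × StepCrossings T s
insertpoint-step T e s PF eq with isBoundary⇒BoundaryEdge T e | isBoundary T e in isB | specialCol T in spec
insertpoint-step T e s PF () | _ | false | _
insertpoint-step T e s PF () | _ | true  | nothing
insertpoint-step T (rowN r) s PF refl | boundary | true | just sc with boundary isB
... | rowEnd .r r<n =
  insert-then-addRibbon T C.T' C.emb ne (proj₁ sp) r (len T r) (proj₂ sp) C.pointedFerrers' C.r<nrows' C.L<len'
    (C.emb-cell _ sc (bottomCell T (PointedFerrers.rowsDecrease PF) sc (specialCol<len T spec))) C.crossing'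
  where
    module C = InsertColumn T PF r r<n
    sp = C.emb (colHeight T sc ∸ 1 , sc)
    ne = indexOf (colE sc) (border T) <ᵇ indexOf (rowN r) (border T)
insertpoint-step T (colE c) s PF refl | boundary | true | just sc with boundary isB
... | columnBottom .c r r<n len≤c c<len =
  insert-then-addRibbon T R.T' R.emb ne (proj₁ sp) R.H c (proj₂ sp) R.pointedFerrers' R.H<nrows' R.c<len'
    (R.emb-cell _ sc (bottomCell T (PointedFerrers.rowsDecrease PF) sc (specialCol<len T spec))) R.crossing'
  where
    module R = InsertRow T PF c r r<n len≤c c<len
    sp = R.emb (colHeight T sc ∸ 1 , sc)
    ne = indexOf (colE sc) (border T) <ᵇ indexOf (colE c) (border T)

run-crossings : ∀ T es steps → PointedFerrers T → run T es ≡ just steps → ∀ i j →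
                Crossing (finalTab T steps) i j ⇔ (Image (transport steps) (Crossing T) i j ⊎ InRibbons steps i j)
run-crossings T [] .[] PF refl i j =
  mk⇔ (λ c → inj₁ (i , j , c , refl)) λ { (inj₁ image) → Image-elim (Crossing T) (λ _ _ c → c) image ; (inj₂ ()) }
run-crossings T (e ∷ es) steps PF eq with insertpoint T e in ins
run-crossings T (e ∷ es) steps PF () | nothing
... | just s with run (Step.tab s) es in rest
run-crossings T (e ∷ es) steps PF () | just s | nothing
... | just ss with eq
... | refl = λ i j → begin
  Crossing (finalTab (Step.tab s) ss) i j
    ≈⟨ run-crossings (Step.tab s) es ss PF' rest i j ⟩
  (Image (transport ss) (Crossing (Step.tab s)) i j ⊎ InRibbons ss i j)
    ≈⟨ Image-cong (transport ss) crossings i j ⊎-⇔ ⇔-id _ ⟩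
  (Image (transport ss) (λ a b → Image (Step.emb s) (Crossing T) a b ⊎ Step.rib s a b ≡ true) i j ⊎ InRibbons ss i j)
    ≈⟨ Image-⊎ (transport ss) i j ⊎-⇔ ⇔-id _ ⟩
  ((Image (transport ss) (Image (Step.emb s) (Crossing T)) i j ⊎ Image (transport ss) (λ a b → Step.rib s a b ≡ true) i j)
    ⊎ InRibbons ss i j)
    ≈⟨ mk⇔ assocʳ assocˡ ⟩
  (Image (transport ss) (Image (Step.emb s) (Crossing T)) i j ⊎ InRibbons (s ∷ ss) i j)
    ≈⟨ Image-∘ (transport ss) (Step.emb s) i j ⊎-⇔ ⇔-id _ ⟩
  (Image (transport (s ∷ ss)) (Crossing T) i j ⊎ InRibbons (s ∷ ss) i j) ∎
  where
    open ⇔-Reasoning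
    PF' = proj₁ (insertpoint-step T e s PF ins)
    crossings = proj₂ (insertpoint-step T e s PF ins)

pointedFerrers-T1 : PointedFerrers T1
pointedFerrers-T1 = record { rowsDecrease = λ _ → z≤n ; rowPoint = rowPoint ; columnPoint = columnPoint }
  where
    rowPoint : ∀ i → i < 1 → Σ ℕ λ j → pt T1 i j ≡ true
    rowPoint zero _ = 0 , refl
    rowPoint (suc i) (s≤s ())
    columnPoint : ∀ j → j < 1 → Σ ℕ λ i → pt T1 i j ≡ true
    columnPoint zero _ = 0 , refl
    columnPoint (suc j) (s≤s ())

¬crossing-T1 : ∀ i j → ¬ Crossing T1 i j
¬crossing-T1 zero    zero    (_ , () , _)
¬crossing-T1 zero    (suc j) (() , _)
¬crossing-T1 (suc i) j       (() , _)

-- Tree-likeness, the size and the length of the history are not needed: the description of the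
-- crossings holds for every insertion history starting from T1.
lemma3p1 : (n : ℕ) (T : Tab) → TreeLike T → size T ≡ n →
           (es : List Edge) (steps : List Step) →
           suc (length es) ≡ n →
           run T1 es ≡ just steps →
           finalTab T1 steps ≡ T →
           ∀ i j → Crossing T i j ⇔ InRibbons steps i j
lemma3p1 n .(finalTab T1 steps) _ _ es steps _ ran refl i j = begin
  Crossing (finalTab T1 steps) i j
    ≈⟨ run-crossings T1 es steps pointedFerrers-T1 ran i j ⟩
  (Image (transport steps) (Crossing T1) i j ⊎ InRibbons steps i j)
    ≈⟨ mk⇔ (λ { (inj₁ (a , b , c , _)) → contradiction c (¬crossing-T1 a b) ; (inj₂ r) → r }) inj₂ ⟩
  InRibbons steps i j ∎
  where open ⇔-Reasoning
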